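{- Let $\sigma=(E,\#,\to,\mathrm{Drop})$ be an SES and let $\mathrm{des}(\sigma)=(E,\#,\mapsto)$ be the DES whose bundles are given by: $S\mapsto y$ iff $S\subseteq E$, $y\in E$, and there is $x\in E$ with $x\to y$ and $S=\{x\}\cup\{d\in E\mid (d,x,y)\in\mathrm{Drop}\}$. Then $\sigma$ and $\mathrm{des}(\sigma)$ have the same set of posets.
   Context: An SES is a tuple $\sigma=(E,\#,\to,\mathrm{Drop})$: $E$ a set of events, $\#\subseteq E^2$ irreflexive and symmetric, $\to\subseteq E^2$, $\mathrm{Drop}\subseteq E^3$ with $(d,c,t)\in\mathrm{Drop}$ implying $c\to t$ and $d\notin\{c,t\}$. Let $\mathrm{ic}(e)=\{e'\mid e'\to e\}$ and $\mathrm{dc}(H,e)=\{e'\mid\exists d\in H.(d,e',e)\in\mathrm{Drop}\}$. For $t=e_1\cdots e_n$ write $\overline t=\{e_1,\dots,e_n\}$, $t_i=e_1\cdots e_i$. A trace of $\sigma$ is a sequence of pairwise distinct events of $E$ with no two in conflict and $\mathrm{ic}(e_i)\setminus\mathrm{dc}(\overline{t_{i-1}},e_i)\subseteq\overline{t_{i-1}}$ for all $i$. A DES is $\delta=(E,\#,\mapsto)$ with $\#$ irreflexive symmetric on $E$ and $\mapsto\subseteq\mathcal P(E)\times E$ (bundles). A trace of $\delta$ is a sequence of pairwise distinct conflict-free events such that every bundle $X\mapsto e_i$ satisfies $X\cap\overline{t_{i-1}}\ne\emptyset$. Posets (early causality): for a trace $t=e_1\cdots e_n$ and sets $U_1\neq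 U_2$ of events of $t$, $U_1$ is earlier than $U_2$ if the largest index $j$ with $e_j\in U_1\setminus U_2$ is smaller than the largest index $j$ with $e_j\in U_2\setminus U_1$. In a DES, the cause $U_i$ of $e_i$ in $t$ is the earliest set $U\subseteq\overline{t_{i-1}}$ with $U\cap X\neq\emptyset$ for every bundle $X\mapsto e_i$. In an SES, the cause $U_i$ of $e_i$ in $t$ is the earliest set $U\subseteq\overline{t_{i-1}}$ with $\mathrm{ic}(e_i)\setminus\mathrm{dc}(U,e_i)\subseteq U$. The poset of $t$ is $(\overline t,\le)$ where $\le$ is the reflexive transitive closure of $\{(c,e_i)\mid 1\le i\le n,\ c\in U_i\}$. The set of posets of a structure is the set of posets of all its traces. -}

module Defs where

open import Level using (0ℓ) renaming (suc to lsuc)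
open import Data.Nat using (ℕ)
open import Data.Fin using (Fin; toℕ; _<_)
open import Data.List using (List; length; lookup; take)
open import Data.List.Membership.Propositional using (_∈_)
open import Data.List.Relation.Unary.Unique.Propositional using (Unique)
open import Data.Product using (Σ; Σ-syntax; ∃; _×_; _,_)
open import Data.Sum using (_⊎_)
open import Relation.Binary.PropositionalEquality using (_≡_; _≢_)
open import Relation.Nullary using (¬_)
open import Relation.Binary.Construct.Closure.ReflexiveTransitive using (Star)

SetOf : Set → Set₁
SetOf E = E → Set

_⇔_ : ∀ {a b} → Set a → Set b → Set _
A ⇔ B = (A → B) × (B → A)

_⊆_ : {E : Set} → SetOf E → SetOf E → Set
U ⊆ V = ∀ e → U e → V e

record SES (E : Set) : Set₁ where
  field
    _#_   : E → E → Set
    #-irrefl : ∀ e → ¬ (e # e)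
    #-sym : ∀ {a b} → a # b → b # a
    _⟶_   : E → E → Set
    Drop  : E → E → E → Set
    Drop⇒⟶ : ∀ {d c t} → Drop d c t → c ⟶ t
    Drop-d≢c : ∀ {d c t} → Drop d c t → d ≢ c
    Drop-d≢t : ∀ {d c t} → Drop d c t → d ≢ t

  ic : E → SetOf E
  ic e e′ = e′ ⟶ e

  dc : SetOf E → E → SetOf E
  dc H e e′ = Σ[ d ∈ E ] (H d × Drop d e′ e)

record DES (E : Set) : Set₁ where
  field
    _#_   : E → E → Set
    #-irrefl : ∀ e → ¬ (e # e)
    #-sym : ∀ {a b} → a # b → b # a
    _↦_   : SetOf E → E → Set

module _ {E : Set} where

  ⟦_⟧ : List E → SetOf E
  ⟦ l ⟧ e = e ∈ l

  -- \overline{t_{i-1}} for the (0-based) position i, i.e. events strictly before i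
  before : (t : List E) → Fin (length t) → SetOf E
  before t i = ⟦ take (toℕ i) t ⟧

  ConflictFreeDistinct : (E → E → Set) → List E → Set
  ConflictFreeDistinct _#_ t =
    Unique t × (∀ i j → ¬ (lookup t i # lookup t j))

  -- U₁ is earlier than U₂ (w.r.t. trace t): the largest index in U₁ \ U₂ is
  -- smaller than the largest index in U₂ \ U₁ (max of the empty set taken below
  -- every index).
  Earlier : (t : List E) → SetOf E → SetOf E → Set
  Earlier t U₁ U₂ =
    Σ[ j ∈ Fin (length t) ]
      ( U₂ (lookup t j) × ¬ U₁ (lookup t j)
      × (∀ k → j < k → U₁ (lookup t k) → U₂ (lookup t k)) )

  IsEarliest : (t : List E) → Fin (length t) → (SetOf E → Set₁) → SetOf E → Set₁
  IsEarliest t i P U =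
    U ⊆ before t i × P U ×
    (∀ (U′ : SetOf E) → U′ ⊆ before t i → P U′ →
       (∀ e → U e ⇔ U′ e) ⊎ Earlier t U U′)

  PosetData : Set₂
  PosetData = SetOf E × (E → E → Set₁)

  module PosetOf (Prop : (t : List E) → Fin (length t) → SetOf E → Set₁) where

    Cause : (t : List E) → Fin (length t) → SetOf E → Set₁
    Cause t i U = IsEarliest t i (Prop t i) U

    Step : List E → E → E → Set₁
    Step t c e = Σ[ i ∈ Fin (length t) ]
      (e ≡ lookup t i × Σ[ U ∈ SetOf E ] (Cause t i U × U c))

    Le : List E → E → E → Set₁
    Le t a b = Lift′ (⟦ t ⟧ a) × Lift′ (⟦ t ⟧ b) × Star (Step t) a b
      where
        Lift′ : Set → Set₁
        Lift′ A = Level.Lift (lsuc 0ℓ) A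
          where import Level

    posetOf : List E → PosetData
    posetOf t = ⟦ t ⟧ , Le t

SamePoset : {E : Set} → PosetData {E} → PosetData {E} → Set₁
SamePoset (C , R) (C′ , R′) = (∀ e → C e ⇔ C′ e) × (∀ a b → R a b ⇔ R′ a b)

module SESDefs {E : Set} (σ : SES E) where
  open SES σ

  IsTrace : List E → Set
  IsTrace t = ConflictFreeDistinct _#_ t ×
    (∀ i → ic (lookup t i) ⊆ λ e → ¬ dc (before t i) (lookup t i) e → before t i e)

  CauseProp : (t : List E) → Fin (length t) → SetOf E → Set₁
  CauseProp t i U = Level.Lift (Level.suc Level.zero) (
    ∀ e → ic (lookup t i) e → ¬ dc U (lookup t i) e → U e)
    where import Level

  open PosetOf CauseProp public

  Posets : PosetData {E} → Set₁
  Posets p = Σ[ t ∈ List E ] (IsTrace t × SamePoset p (posetOf t))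

module DESDefs {E : Set} (δ : DES E) where
  open DES δ

  IsTrace : List E → Set₁
  IsTrace t = Level.Lift (Level.suc Level.zero) (ConflictFreeDistinct _#_ t) ×
    (∀ i (X : SetOf E) → X ↦ lookup t i → Σ[ e ∈ E ] (X e × before t i e))
    where import Level

  CauseProp : (t : List E) → Fin (length t) → SetOf E → Set₁
  CauseProp t i U = ∀ (X : SetOf E) → X ↦ lookup t i → Σ[ e ∈ E ] (X e × U e)

  Posets : PosetData {E} → Set₁
  Posets p = Σ[ t ∈ List E ] (IsTrace t × SamePoset p (posetOf t))
    where open PosetOf CauseProp

des : {E : Set} → SES E → DES E
des {E} σ = record
  { _#_ = _#_
  ; #-irrefl = #-irrefl
  ; #-sym = #-sym
  ; _↦_ = λ S y → Σ[ x ∈ E ] (x ⟶ y × (∀ z → S z ⇔ (z ≡ x ⊎ Drop z x y)))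
  }
  where open SES σ

-- An SES event e is enabled by U (every initial cause of e is in U unless a
-- member of U drops it) exactly when U meets every bundle {x} ∪ {d | (d,x,e) ∈ Drop}
-- of des(σ): given x ⟶ e, either some d ∈ U drops x, or x itself must lie in U.
-- Case-splitting on "is x dropped by U" is the only use of excluded middle.
-- Hence the two structures have the same traces and, for every trace and every
-- position, the same candidate causes and so the same earliest cause; the posets
-- they generate coincide.
module Submission where

open import Defs
open import Level using (0ℓ; lift; lower) renaming (suc to lsuc)
open import Axiom.ExcludedMiddle using (ExcludedMiddle)
open import Data.List using (List; length)
open import Data.Fin using (Fin)
open import Data.Product using (Σ-syntax; _×_; _,_; proj₁; proj₂)
open import Data.Sum using (_⊎_; inj₁; inj₂)
open import Data.Empty using (⊥-elim)
open import Relation.Nullary using (¬_; yes; no)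
open import Relation.Binary.PropositionalEquality using (_≡_; refl)
import Relation.Binary.Construct.Closure.ReflexiveTransitive as Star

⇔-sym : ∀ {a b} {A : Set a} {B : Set b} → A ⇔ B → B ⇔ A
⇔-sym (f , g) = g , f

SamePoset-trans : ∀ {E : Set} {p q r : PosetData {E}} →
  SamePoset p q → SamePoset q r → SamePoset p r
SamePoset-trans (c , o) (c′ , o′) =
  (λ e → (λ x → proj₁ (c′ e) (proj₁ (c e) x)) , (λ x → proj₂ (c e) (proj₂ (c′ e) x))) ,
  (λ a b → (λ x → proj₁ (o′ a b) (proj₁ (o a b) x)) , (λ x → proj₂ (o a b) (proj₂ (o′ a b) x)))

CauseProperty : Set → Set₂
CauseProperty E = (t : List E) → Fin (length t) → SetOf E → Set₁

module _ {E : Set} (P Q : CauseProperty E) (P⇔Q : ∀ t i U → P t i U ⇔ Q t i U) where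
  private
    module P = PosetOf P
    module Q = PosetOf Q

  Cause-map : ∀ {t i U} → P.Cause t i U → Q.Cause t i U
  Cause-map {t} {i} {U} (U⊆before , PU , earliest) =
    U⊆before , proj₁ (P⇔Q t i U) PU ,
    λ U′ U′⊆before QU′ → earliest U′ U′⊆before (proj₂ (P⇔Q t i U′) QU′)

  Le-map : ∀ {t a b} → P.Le t a b → Q.Le t a b
  Le-map (a∈t , b∈t , steps) =
    a∈t , b∈t , Star.map (λ { (i , e≡eᵢ , U , cause , c∈U) → i , e≡eᵢ , U , Cause-map cause , c∈U }) steps

posetOf-cong : ∀ {E : Set} (P Q : CauseProperty E) → (∀ t i U → P t i U ⇔ Q t i U) →
  ∀ t → SamePoset (PosetOf.posetOf P t) (PosetOf.posetOf Q t)
posetOf-cong P Q P⇔Q t =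
  (λ e → (λ x → x) , (λ x → x)) ,
  (λ a b → Le-map P Q P⇔Q , Le-map Q P (λ t i U → ⇔-sym (P⇔Q t i U)))

module _ {E : Set} (σ : SES E) where
  open SES σ
  open DES (des σ) using (_↦_)
  private
    module S = SESDefs σ
    module D = DESDefs (des σ)

  Enables : SetOf E → E → Set
  Enables U e = ∀ x → ic e x → ¬ dc U e x → U x

  MeetsBundles : SetOf E → E → Set₁
  MeetsBundles U e = ∀ X → X ↦ e → Σ[ z ∈ E ] (X z × U z)

  enables⇒meetsBundles : ExcludedMiddle 0ℓ → ∀ {U e} → Enables U e → MeetsBundles U e
  enables⇒meetsBundles em {U} {e} U-enables X (x , x⟶e , X≐bundle) with em {dc U e x}
  ... | yes (d , d∈U , dropped) = d , proj₂ (X≐bundle d) (inj₂ dropped) , d∈U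
  ... | no undropped = x , proj₂ (X≐bundle x) (inj₁ refl) , U-enables x x⟶e undropped

  meetsBundles⇒enables : ∀ {U e} → MeetsBundles U e → Enables U e
  meetsBundles⇒enables {U} {e} meets x x⟶e undropped
    with meets (λ z → z ≡ x ⊎ Drop z x e) (x , x⟶e , λ z → (λ p → p) , (λ p → p))
  ... | _ , inj₁ refl , x∈U = x∈U
  ... | d , inj₂ dropped , d∈U = ⊥-elim (undropped (d , d∈U , dropped))

  module _ (em : ExcludedMiddle 0ℓ) where

    CauseProp⇔ : ∀ t i U → S.CauseProp t i U ⇔ D.CauseProp t i U
    CauseProp⇔ t i U =
      (λ h → enables⇒meetsBundles em (lower h)) , (λ h → lift (meetsBundles⇒enables h))

    IsTrace⇔ : ∀ t → S.IsTrace t ⇔ D.IsTrace t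
    IsTrace⇔ t =
      (λ { (cfd , enabled) → lift cfd , λ i → enables⇒meetsBundles em (enabled i) }) ,
      (λ { (cfd , meets) → lower cfd , λ i → meetsBundles⇒enables (meets i) })

theorem4p9 : ExcludedMiddle 0ℓ → ExcludedMiddle (lsuc 0ℓ) →
    {E : Set} (σ : SES E) →
    ∀ (p : PosetData {E}) → SESDefs.Posets σ p ⇔ DESDefs.Posets (des σ) p
theorem4p9 em _ σ p =
  (λ { (t , trace , same) → t , proj₁ (IsTrace⇔ σ em t) trace , SamePoset-trans same (sesToDes t) }) ,
  (λ { (t , trace , same) → t , proj₂ (IsTrace⇔ σ em t) trace , SamePoset-trans same (desToSes t) })
  where
    module S = SESDefs σ
    module D = DESDefs (des σ)

    sesToDes : ∀ t → SamePoset (S.posetOf t) (PosetOf.posetOf D.CauseProp t)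
    sesToDes = posetOf-cong S.CauseProp D.CauseProp (CauseProp⇔ σ em)

    desToSes : ∀ t → SamePoset (PosetOf.posetOf D.CauseProp t) (S.posetOf t)
    desToSes = posetOf-cong D.CauseProp S.CauseProp (λ t i U → ⇔-sym (CauseProp⇔ σ em t i U))
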